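{- Let $F\colon\mathbf{Sets}\to\mathbf{Sets}$ be a functor which preserves weak pullbacks, $\lambda\colon F\mathcal{P}\Rightarrow\mathcal{P}F$ the distributive law given by relation lifting, and $\overline{F}$ its induced lifting on $\mathcal{K}\ell(\mathcal{P})$. Then the components $\lambda_X\colon F\mathcal{P}X\to\mathcal{P}FX$ also form a natural transformation $F\circ K\circ\mathit{Op}\Rightarrow K\circ\mathit{Op}\circ\overline{F}^{\mathrm{op}}\colon\mathcal{K}\ell(\mathcal{P})^{\mathrm{op}}\to\mathbf{Sets}$.
   Context: $\mathcal{P}$ is the powerset monad (unit $\eta$ singletons, multiplication $\mu$ union). $\mathcal{K}\ell(\mathcal{P})$: objects sets, arrows $X\to Y$ functions $X\to\mathcal{P}Y$, composition $g\circ f=\mu\circ\mathcal{P}g\circ f$. $K\colon\mathcal{K}\ell(\mathcal{P})\to\mathbf{Sets}$ is $KX=\mathcal{P}X$, $Kf=\mu_Y\circ\mathcal{P}f$. $\mathit{Op}\colon\mathcal{K}\ell(\mathcal{P})^{\mathrm{op}}\to\mathcal{K}\ell(\mathcal{P})$ is the isomorphism that is the identity on objects and sends $f\colon X\to\mathcal{P}Y$ to $f^\vee\colon Y\to\mathcal{P}X$, $f^\vee(y)=\{x\mid y\in f(x)\}$ (converse relation). For a relation $R\subseteq X\times Y$, $\mathrm{Rel}_F(R)\subseteq FX\times FY$ is the image of $\langle Fr_1,Fr_2\rangle\colon FR\to FX\times FY$. The distributive law is $\lambda_X(u)=\{v\in FX\mid(v,u)\in\mathrm{Rel}_F(\in_X)\}$,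 and the lifting is $\overline{F}X=FX$, $\overline{F}f=\lambda_Y\circ Ff$ (equivalently $\overline{F}R=\mathrm{Rel}_F(R)$). -}

module Defs where

open import Level using (Level; _⊔_; suc; 0ℓ; Setω)
open import Function using (_∘_; id)
open import Data.Product using (Σ; ∃; _×_; _,_; proj₁; proj₂)
open import Relation.Binary.PropositionalEquality using (_≡_)

-- "Sets" is modelled by Agda types; an endofunctor of Sets is a
-- universe-polymorphic type former with a functorial action.
-- Subsets of X are predicates X → Set ℓ (the powerset P).
Pow : ∀ {a} (ℓ : Level) → Set a → Set (a ⊔ suc ℓ)
Pow ℓ X = X → Set ℓ

_∈_ : ∀ {a ℓ} {X : Set a} → X → Pow ℓ X → Set ℓ
x ∈ S = S x

-- converse relation f^∨ (the functor Op on arrows)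
_ᵛ : ∀ {a b ℓ} {X : Set a} {Y : Set b} → (X → Pow ℓ Y) → (Y → Pow ℓ X)
(f ᵛ) y x = f x y

-- K f = μ ∘ P f : P X → P Y,   (K f)(S) = ⋃_{x ∈ S} f x
K : ∀ {a b ℓ ℓ'} {X : Set a} {Y : Set b} →
    (X → Pow ℓ Y) → Pow ℓ' X → Pow (a ⊔ ℓ ⊔ ℓ') Y
K {X = X} f S y = Σ X (λ x → x ∈ S × y ∈ f x)

record IsWeakPullback {a b c w} {A : Set a} {B : Set b} {C : Set c} {W : Set w}
    (f : A → C) (g : B → C) (p : W → A) (q : W → B) : Set (a ⊔ b ⊔ c ⊔ w) where
  field
    commutes : ∀ z → f (p z) ≡ g (q z)
    weak     : ∀ x y → f x ≡ g y → Σ W (λ z → p z ≡ x × q z ≡ y)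

record Functor : Setω where
  field
    F₀    : ∀ {ℓ} → Set ℓ → Set ℓ
    F₁    : ∀ {a b} {A : Set a} {B : Set b} → (A → B) → F₀ A → F₀ B
    F-id  : ∀ {a} {A : Set a} (x : F₀ A) → F₁ (id {A = A}) x ≡ x
    F-∘   : ∀ {a b c} {A : Set a} {B : Set b} {C : Set c}
              (f : A → B) (g : B → C) (x : F₀ A) → F₁ (g ∘ f) x ≡ F₁ g (F₁ f x)
    -- functions in Sets are extensional
    F-cong : ∀ {a b} {A : Set a} {B : Set b} (f g : A → B) →
               (∀ x → f x ≡ g x) → ∀ x → F₁ f x ≡ F₁ g x

module _ (Fun : Functor) where
  open Functor Fun

  PreservesWeakPullbacks : Setω
  PreservesWeakPullbacks =
    ∀ {a b c w} {A : Set a} {B : Set b} {C : Set c} {W : Set w}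
      (f : A → C) (g : B → C) (p : W → A) (q : W → B) →
      IsWeakPullback f g p q → IsWeakPullback (F₁ f) (F₁ g) (F₁ p) (F₁ q)

  -- relation lifting: Rel_F(R) = image of ⟨F r₁, F r₂⟩ : F R → F X × F Y
  RelF : ∀ {a b ℓ} {X : Set a} {Y : Set b} → (X → Y → Set ℓ) →
         F₀ X → F₀ Y → Set (a ⊔ b ⊔ ℓ)
  RelF {X = X} {Y = Y} R v u =
    Σ (F₀ (Σ (X × Y) (λ xy → R (proj₁ xy) (proj₂ xy))))
      (λ w → F₁ (proj₁ ∘ proj₁) w ≡ v × F₁ (proj₂ ∘ proj₁) w ≡ u)

  distr : ∀ {a ℓ} {X : Set a} → F₀ (Pow ℓ X) → Pow (a ⊔ suc ℓ) (F₀ X)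
  distr u v = RelF _∈_ v u

  Fbar : ∀ {a b ℓ} {X : Set a} {Y : Set b} →
         (X → Pow ℓ Y) → F₀ X → Pow (b ⊔ suc ℓ) (F₀ Y)
  Fbar f = distr ∘ F₁ f

module Submission where

-- Unfolded, the claim for f : X → P Y, u ∈ F(P Y), v ∈ F X reads
--     (v , F(K f^∨) u) ∈ Rel_F(∈_X)
--       ⇔  ∃ t ∈ F Y.  (t , u) ∈ Rel_F(∈_Y)  ∧  (t , F f v) ∈ Rel_F(∈_Y).
-- We prove it from three structural properties of relation lifting:
--   * converse:     Rel_F(R^op) = Rel_F(R)^op                 (any functor);
--   * reindexing:   Rel_F(R ∘ (id × g)) = (id × F g)⁻¹ Rel_F(R);
--   * composition:  Rel_F(R ⨾ S) = Rel_F(R) ⨾ Rel_F(S);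
-- the last two need F to preserve weak pullbacks, which is used only
-- through the lemma lifting a pair matched in F C to the canonical pullback.
-- Since  x ∈ K f^∨ (S)  is literally the composite relation  (∋_Y ⨾ f^∨)(S , x),
-- the theorem is a chain of these three equivalences.

open import Defs
open import Level using (Level; _⊔_; 0ℓ)
open import Function using (_∘_; flip)
open import Function.Bundles using (_⇔_; mk⇔)
open import Function.Related.Propositional using (module EquationalReasoning)
open import Function.Construct.Symmetry using (⇔-sym)
open import Data.Product using (Σ; _×_; _,_; proj₁; proj₂)
open import Data.Product.Function.Dependent.Propositional using (congˡ)
open import Data.Product.Function.NonDependent.Propositional using (_×-⇔_)
open import Relation.Binary.PropositionalEquality using (_≡_; refl; sym; trans; cong; subst)

private variable
  a b c d ℓ ℓ' : Level
  A : Set a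
  B : Set b
  C : Set c
  D : Set d

record Pullback {A : Set a} {B : Set b} {C : Set c} (f : A → C) (g : B → C) : Set (a ⊔ b ⊔ c) where
  constructor _,_⟨_⟩
  field
    outl     : A
    outr     : B
    commutes : f outl ≡ g outr
open Pullback

pullback-isWeak : (f : A → C) (g : B → C) → IsWeakPullback f g (outl {f = f} {g}) outr
pullback-isWeak f g = record
  { commutes = commutes
  ; weak     = λ x y e → (x , y ⟨ e ⟩) , refl , refl
  }

Graph : {A : Set a} {B : Set b} → (A → B → Set ℓ) → Set (a ⊔ b ⊔ ℓ)
Graph {A = A} {B = B} R = Σ (A × B) (λ xy → R (proj₁ xy) (proj₂ xy))

_⨾_ : {B : Set b} → (A → B → Set ℓ) → (B → C → Set ℓ') → A → C → Set (b ⊔ ℓ ⊔ ℓ')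
_⨾_ {B = B} R S x z = Σ B (λ y → R x y × S y z)

module _ (Fun : Functor) where
  open Functor Fun

  map-∘ : (h : A → B) (g : B → C) {w : F₀ A} {w' : F₀ B} {c : F₀ C} →
          F₁ h w ≡ w' → F₁ g w' ≡ c → F₁ (g ∘ h) w ≡ c
  map-∘ h g {w} p q = trans (F-∘ h g w) (trans (cong (F₁ g) p) q)

  relF-intro : {R : A → B → Set ℓ} {v : F₀ A} {u : F₀ B}
               (h : D → Graph R) (w : F₀ D) →
               F₁ (proj₁ ∘ proj₁ ∘ h) w ≡ v → F₁ (proj₂ ∘ proj₁ ∘ h) w ≡ u →
               RelF Fun R v u
  relF-intro h w p q =
    F₁ h w , trans (sym (F-∘ h _ w)) p , trans (sym (F-∘ h _ w)) q

  relF-flip : {R : A → B → Set ℓ} {v : F₀ A} {u : F₀ B} →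
              RelF Fun (flip R) u v → RelF Fun R v u
  relF-flip (w , p , q) = relF-intro (λ { ((y , x) , r) → (x , y) , r }) w q p

  relF-converse : {R : A → B → Set ℓ} {v : F₀ A} {u : F₀ B} →
                  RelF Fun (flip R) u v ⇔ RelF Fun R v u
  relF-converse = mk⇔ relF-flip relF-flip

  module _ (pwp : PreservesWeakPullbacks Fun) where

    lift-pullback : (f : A → C) (g : B → C) {x : F₀ A} {y : F₀ B} →
                    F₁ f x ≡ F₁ g y →
                    Σ (F₀ (Pullback f g)) (λ z → F₁ outl z ≡ x × F₁ outr z ≡ y)
    lift-pullback f g = IsWeakPullback.weak (pwp f g outl outr (pullback-isWeak f g)) _ _

    relF-reindex : {R : A → B → Set ℓ} (g : C → B) {v : F₀ A} {u : F₀ C} →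
                   RelF Fun (λ x b → R x (g b)) v u ⇔ RelF Fun R v (F₁ g u)
    relF-reindex {R = R} g = mk⇔ push pull
      where
        push : ∀ {v u} → RelF Fun (λ x b → R x (g b)) v u → RelF Fun R v (F₁ g u)
        push (w , p , q) =
          relF-intro (λ { ((x , b) , r) → (x , g b) , r }) w p (map-∘ _ g q refl)

        pull : ∀ {v u} → RelF Fun R v (F₁ g u) → RelF Fun (λ x b → R x (g b)) v u
        pull (w , p , q) with lift-pullback (proj₂ ∘ proj₁) g q
        ... | z , zl , zr =
          relF-intro (λ { ((((x , y) , r) , b ⟨ e ⟩)) → (x , b) , subst (R x) e r })
                     z (map-∘ outl (proj₁ ∘ proj₁) zl p) zr

    relF-comp : {R : A → B → Set ℓ} {S : B → C → Set ℓ'} {v : F₀ A} {u : F₀ C} →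
                RelF Fun (R ⨾ S) v u ⇔ Σ (F₀ B) (λ t → RelF Fun R v t × RelF Fun S t u)
    relF-comp {R = R} {S = S} = mk⇔ split join
      where
        split : ∀ {v u} → RelF Fun (R ⨾ S) v u →
                Σ (F₀ _) (λ t → RelF Fun R v t × RelF Fun S t u)
        split (w , p , q) =
            F₁ (λ { ((x , z) , (y , r , s)) → y }) w
          , relF-intro (λ { ((x , z) , (y , r , s)) → (x , y) , r }) w p refl
          , relF-intro (λ { ((x , z) , (y , r , s)) → (y , z) , s }) w refl q

        join : ∀ {v u} → Σ (F₀ _) (λ t → RelF Fun R v t × RelF Fun S t u) →
               RelF Fun (R ⨾ S) v u
        join (t , (w₁ , p₁ , q₁) , (w₂ , p₂ , q₂))
          with lift-pullback (proj₂ ∘ proj₁) (proj₁ ∘ proj₁) (trans q₁ (sym p₂))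
        ... | z , zl , zr =
          relF-intro
            (λ { ((((x , y) , r) , ((y' , z) , s) ⟨ e ⟩)) →
                   (x , z) , y , r , subst (λ y → S y z) (sym e) s })
            z (map-∘ outl (proj₁ ∘ proj₁) zl p₁) (map-∘ outr (proj₂ ∘ proj₁) zr q₂)

lemma5p8 : (Fun : Functor) → PreservesWeakPullbacks Fun →
    (X Y : Set) (f : X → Pow 0ℓ Y) (u : Functor.F₀ Fun (Pow 0ℓ Y)) (v : Functor.F₀ Fun X) →
    distr Fun (Functor.F₁ Fun (K (f ᵛ)) u) v ⇔ K (Fbar Fun f ᵛ) (distr Fun u) v
lemma5p8 Fun pwp X Y f u v =
  begin
    RelF Fun _∈_ v (F₁ (K (f ᵛ)) u)
  ∼⟨ ⇔-sym (relF-reindex Fun pwp (K (f ᵛ))) ⟩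
    RelF Fun (flip (flip _∈_ ⨾ (λ y x → x ∈ (f ᵛ) y))) v u
  ∼⟨ ⇔-sym (relF-converse Fun) ⟩
    RelF Fun (flip _∈_ ⨾ (λ y x → x ∈ (f ᵛ) y)) u v
  ∼⟨ relF-comp Fun pwp ⟩
    Σ (F₀ Y) (λ t → RelF Fun (flip _∈_) u t × RelF Fun (λ y x → y ∈ f x) t v)
  ∼⟨ congˡ (relF-converse Fun ×-⇔ relF-reindex Fun pwp f) ⟩
    Σ (F₀ Y) (λ t → RelF Fun _∈_ t u × RelF Fun _∈_ t (F₁ f v))
  ∎
  where
    open Functor Fun
    open EquationalReasoning
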